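{- Let $\mathcal{C}$ be a clique partition of the complete graph $K_n$ all of whose cliques have size at most $n-1$. Then $\sum_{C\in\mathcal{C}} |C|\geq 3n-3$.
   Context: A clique in a graph is a set of mutually adjacent vertices. A clique partition of a graph $G$ is a family $\mathcal{C}$ of cliques of $G$ such that the two endpoints of every edge of $G$ lie together in exactly one member of $\mathcal{C}$. -}

module Defs where

open import Data.Nat using (ℕ; _+_)
open import Data.Fin using (Fin)
open import Data.Fin.Subset using (Subset; _∈_; ∣_∣)
open import Data.Fin.Subset.Properties using (_∈?_)
open import Data.List using (List; filter; length; map)
open import Data.Nat.ListAction using (sum)
open import Data.Product using (_×_)
open import Relation.Binary.PropositionalEquality using (_≡_; _≢_)
open import Relation.Nullary.Decidable using (_×-dec_)

-- Vertices of the complete graph K_n are Fin n; every subset of vertices is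
-- a clique of K_n.  A family of cliques is a list of subsets (required
-- duplicate-free in the statement, so it represents a set of cliques).

membersContaining : {n : ℕ} → List (Subset n) → Fin n → Fin n → List (Subset n)
membersContaining 𝒞 i j = filter (λ C → (i ∈? C) ×-dec (j ∈? C)) 𝒞

IsCliquePartitionKn : {n : ℕ} → List (Subset n) → Set
IsCliquePartitionKn {n} 𝒞 =
  (i j : Fin n) → i ≢ j → length (membersContaining 𝒞 i j) ≡ 1

totalSize : {n : ℕ} → List (Subset n) → ℕ
totalSize 𝒞 = sum (map ∣_∣ 𝒞)

-- Let r(u) be the number of cliques through the vertex u, so that the total size is Σᵤ r(u).
-- Since every other vertex meets u in exactly one clique, Σ_{C ∋ u} |C| = r(u) + (n − 1); as all
-- cliques are proper this forces r(u) ≥ 2, and if all cliques have at most two vertices it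
-- forces r(u) ≥ n − 1.  A clique A that avoids u meets each clique through u at most once, so
-- r(u) ≥ |A|.  Hence a clique A of size k ≥ 3 gives Σᵤ r(u) ≥ 2k + k(n − k) ≥ 3n − 3, and
-- otherwise Σᵤ r(u) ≥ n(n − 1), which is at least 3n − 3 for n ≥ 3.
module Submission where

open import Defs
open import Data.Bool using (Bool; true; false; _∧_)
open import Data.Fin using (Fin; zero; suc; punchIn; punchOut)
open import Data.Fin.Properties as Fin using (any?; punchInᵢ≢i; punchIn-punchOut)
open import Data.Fin.Subset using (Subset; inside; outside; _∈_; _∉_; _∩_; ∁; ∣_∣; Empty)
open import Data.Fin.Subset.Properties
  using (_∈?_; x∈p∩q⁺; x∈p∩q⁻; x∈p⇒x∉∁p; x∉p⇒x∈∁p; Empty-unique; ∣⊥∣≡0; ∣∁p∣≡n∸∣p∣)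
open import Data.List using (List; []; _∷_; length; lookup; map; filter)
open import Data.List.Membership.Propositional.Properties using (∈-lookup)
open import Data.List.Relation.Unary.All as All using (All)
open import Data.List.Relation.Unary.Unique.Propositional using (Unique)
open import Data.Nat using (ℕ; zero; suc; _+_; _*_; _∸_; _≤_; z≤n; s≤s; _≤?_)
open import Data.Nat.ListAction as List using ()
open import Data.Nat.Properties
open import Algebra.Properties.CommutativeSemigroup *-commutativeSemigroup using (x∙yz≈y∙xz)
open import Algebra.Properties.Semiring.Sum +-*-semiring
  using (sum-syntax; sum-cong-≗; sum-remove; ∑-comm; ∑-distrib-+; *-distribˡ-sum; *-distribʳ-sum)
open import Data.Nat.Solver using (module +-*-Solver)
open +-*-Solver using (solve; _:+_; _:*_; _:=_; con)
open import Data.Product using (_,_; proj₁; proj₂)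
open import Data.Vec using ([]; _∷_; here; there)
open import Function using (_∘_)
open import Relation.Binary.PropositionalEquality
open import Relation.Nullary using (yes; no; does; contradiction)
open import Relation.Nullary.Decidable using (_×-dec_; dec-true; dec-false)
open import Relation.Unary using (Decidable)

∑-mono-≤ : ∀ {n} {f g : Fin n → ℕ} → (∀ i → f i ≤ g i) → ∑[ i < n ] f i ≤ ∑[ i < n ] g i
∑-mono-≤ {zero}  f≤g = z≤n
∑-mono-≤ {suc n} f≤g = +-mono-≤ (f≤g zero) (∑-mono-≤ (f≤g ∘ suc))

∑-const : ∀ n k → ∑[ i < n ] k ≡ n * k
∑-const zero    k = refl
∑-const (suc n) k = cong (k +_) (∑-const n k)

∑-≡1-except : ∀ {n} (f : Fin (suc n) → ℕ) i → (∀ j → j ≢ i → f j ≡ 1) → ∑[ j < suc n ] f j ≡ f i + n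
∑-≡1-except {n} f i f≡1 = begin
  ∑[ j < suc n ] f j                ≡⟨ sum-remove {i = i} f ⟩
  f i + ∑[ j < n ] f (punchIn i j)  ≡⟨ cong (f i +_) (sum-cong-≗ (λ j → f≡1 _ (punchInᵢ≢i i j))) ⟩
  f i + ∑[ j < n ] 1                ≡⟨ cong (f i +_) (trans (∑-const n 1) (*-identityʳ n)) ⟩
  f i + n                           ∎
  where open ≡-Reasoning

term≤∑ : ∀ {n} (f : Fin n → ℕ) i → f i ≤ ∑[ j < n ] f j
term≤∑ {suc n} f i = ≤-trans (m≤m+n (f i) _) (≤-reflexive (sym (sum-remove {i = i} f)))

2≤∑ : ∀ {n} (f : Fin n → ℕ) {i j} → i ≢ j → 1 ≤ f i → 1 ≤ f j → 2 ≤ ∑[ k < n ] f k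
2≤∑ {suc n} f {i} {j} i≢j 1≤fi 1≤fj = begin
  1 + 1                                     ≤⟨ +-mono-≤ 1≤fi (≤-trans 1≤fj f[j]≤rest) ⟩
  f i + ∑[ k < n ] f (punchIn i k)          ≡⟨ sum-remove {i = i} f ⟨
  ∑[ k < suc n ] f k                        ∎
  where
  open ≤-Reasoning
  f[j]≤rest : f j ≤ ∑[ k < n ] f (punchIn i k)
  f[j]≤rest = subst (λ j′ → f j′ ≤ _) (punchIn-punchOut i≢j) (term≤∑ (f ∘ punchIn i) (punchOut i≢j))

𝟙 : Bool → ℕ
𝟙 true  = 1
𝟙 false = 0

𝟙-∧ : ∀ a b → 𝟙 (a ∧ b) ≡ 𝟙 a * 𝟙 b
𝟙-∧ true  b = sym (+-identityʳ (𝟙 b))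
𝟙-∧ false b = refl

𝟙-idem : ∀ a → 𝟙 a * 𝟙 a ≡ 𝟙 a
𝟙-idem true  = refl
𝟙-idem false = refl

χ : ∀ {n} → Subset n → Fin n → ℕ
χ p x = 𝟙 (does (x ∈? p))

module _ {n : ℕ} {p : Subset n} {x : Fin n} where

  χ-∈ : x ∈ p → χ p x ≡ 1
  χ-∈ x∈p = cong 𝟙 (dec-true (x ∈? p) x∈p)

  χ-∉ : x ∉ p → χ p x ≡ 0
  χ-∉ x∉p = cong 𝟙 (dec-false (x ∈? p) x∉p)

χ-∩ : ∀ {n} (p q : Subset n) x → χ (p ∩ q) x ≡ χ p x * χ q x
χ-∩ p q x with x ∈? p | x ∈? q
... | yes x∈p | yes x∈q = χ-∈ (x∈p∩q⁺ (x∈p , x∈q))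
... | yes _   | no x∉q  = χ-∉ (x∉q ∘ proj₂ ∘ x∈p∩q⁻ p q)
... | no x∉p  | _       = χ-∉ (x∉p ∘ proj₁ ∘ x∈p∩q⁻ p q)

∣∣≡∑χ : ∀ {n} (p : Subset n) → ∣ p ∣ ≡ ∑[ x < n ] χ p x
∣∣≡∑χ []            = refl
∣∣≡∑χ (inside  ∷ p) = cong suc (∣∣≡∑χ p)
∣∣≡∑χ (outside ∷ p) = ∣∣≡∑χ p

∣∩∣≡∑χ*χ : ∀ {n} (p q : Subset n) → ∣ p ∩ q ∣ ≡ ∑[ x < n ] (χ p x * χ q x)
∣∩∣≡∑χ*χ p q = trans (∣∣≡∑χ (p ∩ q)) (sum-cong-≗ (χ-∩ p q))

∣∣≤1 : ∀ {n} (p : Subset n) → (∀ {x y} → x ∈ p → y ∈ p → x ≡ y) → ∣ p ∣ ≤ 1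
∣∣≤1 []            _      = z≤n
∣∣≤1 (outside ∷ p) unique = ∣∣≤1 p (λ x∈p y∈p → Fin.suc-injective (unique (there x∈p) (there y∈p)))
∣∣≤1 {suc n} (inside ∷ p) unique = s≤s (≤-reflexive (trans (cong ∣_∣ (Empty-unique p-empty)) (∣⊥∣≡0 n)))
  where
  p-empty : Empty p
  p-empty (x , x∈p) with () ← unique here (there x∈p)

sum-map≡∑-lookup : ∀ {a} {A : Set a} (f : A → ℕ) xs → List.sum (map f xs) ≡ ∑[ c < length xs ] f (lookup xs c)
sum-map≡∑-lookup f []       = refl
sum-map≡∑-lookup f (x ∷ xs) = cong (f x +_) (sum-map≡∑-lookup f xs)

length-filter≡∑ : ∀ {a p} {A : Set a} {P : A → Set p} (P? : Decidable P) xs →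
                  length (filter P? xs) ≡ ∑[ c < length xs ] 𝟙 (does (P? (lookup xs c)))
length-filter≡∑ P? []       = refl
length-filter≡∑ P? (x ∷ xs) with does (P? x)
... | true  = cong suc (length-filter≡∑ P? xs)
... | false = length-filter≡∑ P? xs

3n≤2k+k[n+1-k] : ∀ {k n} → 3 ≤ k → k ≤ n → 3 * n ≤ 2 * k + k * (suc n ∸ k)
3n≤2k+k[n+1-k] 3≤k k≤n with m≤n⇒∃[o]m+o≡n 3≤k | m≤n⇒∃[o]m+o≡n k≤n
... | a , refl | b , refl = begin
  3 * (3 + a + b)                                 ≤⟨ m≤m+n _ (a * b) ⟩
  3 * (3 + a + b) + a * b                         ≡⟨ identity a b ⟩
  2 * (3 + a) + (3 + a) * suc b                   ≡⟨ cong (λ t → 2 * (3 + a) + (3 + a) * t) complement ⟨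
  2 * (3 + a) + (3 + a) * (suc (3 + a + b) ∸ (3 + a)) ∎
  where
  open ≤-Reasoning
  identity : ∀ a b → 3 * (3 + a + b) + a * b ≡ 2 * (3 + a) + (3 + a) * suc b
  identity = solve 2 (λ a b → con 3 :* (con 3 :+ a :+ b) :+ a :* b
                              := con 2 :* (con 3 :+ a) :+ (con 3 :+ a) :* (con 1 :+ b)) refl
  complement : suc (3 + a + b) ∸ (3 + a) ≡ suc b
  complement = trans (cong (_∸ (3 + a)) (sym (+-suc (3 + a) b))) (m+n∸m≡n (3 + a) (suc b))

r+n≤r*n⇒2≤r : ∀ {r n} → 1 ≤ n → r + n ≤ r * n → 2 ≤ r
r+n≤r*n⇒2≤r {zero}          1≤n n≤0   = contradiction (≤-trans 1≤n n≤0) λ ()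
r+n≤r*n⇒2≤r {suc zero}  {n} _   1+n≤n = contradiction (≤-trans 1+n≤n (≤-reflexive (*-identityˡ n))) 1+n≰n
r+n≤r*n⇒2≤r {suc (suc r)} _ _ = s≤s (s≤s z≤n)

-- The graph is K_{n+1} here, so that its vertex set Fin (suc n) is visibly nonempty.
module CliquePartition {n : ℕ} (𝒞 : List (Subset (suc n))) (isPartition : IsCliquePartitionKn 𝒞) where

  m : ℕ
  m = length 𝒞

  K : Fin m → Subset (suc n)
  K = lookup 𝒞

  degree : Fin (suc n) → ℕ
  degree u = ∑[ c < m ] χ (K c) u

  pairCount : Fin (suc n) → Fin (suc n) → ℕ
  pairCount u v = ∑[ c < m ] (χ (K c) u * χ (K c) v)

  pairCount≡1 : ∀ {u v} → u ≢ v → pairCount u v ≡ 1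
  pairCount≡1 {u} {v} u≢v = begin
    pairCount u v                                                  ≡⟨ sum-cong-≗ (λ c → 𝟙-∧ (does (u ∈? K c)) (does (v ∈? K c))) ⟨
    ∑[ c < m ] 𝟙 (does ((u ∈? K c) ×-dec (v ∈? K c)))              ≡⟨ length-filter≡∑ _ 𝒞 ⟨
    length (membersContaining 𝒞 u v)                               ≡⟨ isPartition u v u≢v ⟩
    1                                                              ∎
    where open ≡-Reasoning

  pairCount-diag : ∀ u → pairCount u u ≡ degree u
  pairCount-diag u = sum-cong-≗ (λ c → 𝟙-idem (does (u ∈? K c)))

  totalSize≡∑degree : totalSize 𝒞 ≡ ∑[ u < suc n ] degree u
  totalSize≡∑degree = begin
    totalSize 𝒞                            ≡⟨ sum-map≡∑-lookup ∣_∣ 𝒞 ⟩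
    ∑[ c < m ] ∣ K c ∣                     ≡⟨ sum-cong-≗ (∣∣≡∑χ ∘ K) ⟩
    ∑[ c < m ] ∑[ u < suc n ] χ (K c) u    ≡⟨ ∑-comm (χ ∘ K) ⟩
    ∑[ u < suc n ] degree u                ∎
    where open ≡-Reasoning

  -- Each vertex v ≠ u lies in exactly one clique through u, and u itself in degree u of them.
  ∑-sizes-through : ∀ u → ∑[ c < m ] (χ (K c) u * ∣ K c ∣) ≡ degree u + n
  ∑-sizes-through u = begin
    ∑[ c < m ] (χ (K c) u * ∣ K c ∣)                      ≡⟨ sum-cong-≗ (λ c → cong (χ (K c) u *_) (∣∣≡∑χ (K c))) ⟩
    ∑[ c < m ] (χ (K c) u * ∑[ v < suc n ] χ (K c) v)     ≡⟨ sum-cong-≗ (λ c → *-distribˡ-sum (χ (K c) u) (χ (K c))) ⟩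
    ∑[ c < m ] ∑[ v < suc n ] (χ (K c) u * χ (K c) v)     ≡⟨ ∑-comm (λ c v → χ (K c) u * χ (K c) v) ⟩
    ∑[ v < suc n ] pairCount u v                          ≡⟨ ∑-≡1-except (pairCount u) u (λ v v≢u → pairCount≡1 (v≢u ∘ sym)) ⟩
    pairCount u u + n                                     ≡⟨ cong (_+ n) (pairCount-diag u) ⟩
    degree u + n                                          ∎
    where open ≡-Reasoning

  degree+n≤degree*b : ∀ {b} → (∀ c → ∣ K c ∣ ≤ b) → ∀ u → degree u + n ≤ degree u * b
  degree+n≤degree*b {b} bounded u = begin
    degree u + n                      ≡⟨ ∑-sizes-through u ⟨
    ∑[ c < m ] (χ (K c) u * ∣ K c ∣)  ≤⟨ ∑-mono-≤ (λ c → *-monoʳ-≤ (χ (K c) u) (bounded c)) ⟩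
    ∑[ c < m ] (χ (K c) u * b)        ≡⟨ *-distribʳ-sum b (λ c → χ (K c) u) ⟨
    degree u * b                      ∎
    where open ≤-Reasoning

  2≤degree : 1 ≤ n → (∀ c → ∣ K c ∣ ≤ n) → ∀ u → 2 ≤ degree u
  2≤degree 1≤n proper u = r+n≤r*n⇒2≤r 1≤n (degree+n≤degree*b proper u)

  n≤degree : (∀ c → ∣ K c ∣ ≤ 2) → ∀ u → n ≤ degree u
  n≤degree small u = +-cancelˡ-≤ r n r (≤-trans (degree+n≤degree*b small u) (≤-reflexive r*2≡r+r))
    where
    r = degree u
    r*2≡r+r : r * 2 ≡ r + r
    r*2≡r+r = trans (*-suc r 1) (cong (r +_) (*-identityʳ r))

  ∣∩∣≤1 : ∀ {a c} → a ≢ c → ∣ K a ∩ K c ∣ ≤ 1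
  ∣∩∣≤1 {a} {c} a≢c = ∣∣≤1 (K a ∩ K c) shared-unique
    where
    1≤χ*χ : ∀ {p : Subset (suc n)} {x y} → x ∈ p → y ∈ p → 1 ≤ χ p x * χ p y
    1≤χ*χ x∈p y∈p = ≤-reflexive (sym (cong₂ _*_ (χ-∈ x∈p) (χ-∈ y∈p)))
    shared-unique : ∀ {x y} → x ∈ K a ∩ K c → y ∈ K a ∩ K c → x ≡ y
    shared-unique {x} {y} x∈ y∈ with x Fin.≟ y
    ... | yes x≡y = x≡y
    ... | no  x≢y = contradiction (≤-trans twice (≤-reflexive (pairCount≡1 x≢y))) 1+n≰n
      where
      twice : 2 ≤ pairCount x y
      twice = 2≤∑ (λ d → χ (K d) x * χ (K d) y) a≢c
                (1≤χ*χ (proj₁ (x∈p∩q⁻ _ _ x∈)) (proj₁ (x∈p∩q⁻ _ _ y∈)))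
                (1≤χ*χ (proj₂ (x∈p∩q⁻ _ _ x∈)) (proj₂ (x∈p∩q⁻ _ _ y∈)))

  -- The vertices of K a are sorted by their (unique) clique with u, and each clique through u
  -- other than K a receives at most one of them.
  ∣∣≤degree : ∀ {a u} → u ∉ K a → ∣ K a ∣ ≤ degree u
  ∣∣≤degree {a} {u} u∉Ka = begin
    ∣ K a ∣                                                        ≡⟨ ∣∣≡∑χ (K a) ⟩
    ∑[ x < suc n ] χ (K a) x                                       ≡⟨ sum-cong-≗ weighted ⟩
    ∑[ x < suc n ] (χ (K a) x * pairCount u x)                     ≡⟨ sum-cong-≗ (λ x → *-distribˡ-sum (χ (K a) x) (λ c → χ (K c) u * χ (K c) x)) ⟩
    ∑[ x < suc n ] ∑[ c < m ] (χ (K a) x * (χ (K c) u * χ (K c) x)) ≡⟨ sum-cong-≗ (λ x → sum-cong-≗ (λ c → x∙yz≈y∙xz (χ (K a) x) (χ (K c) u) (χ (K c) x))) ⟩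
    ∑[ x < suc n ] ∑[ c < m ] (χ (K c) u * (χ (K a) x * χ (K c) x)) ≡⟨ ∑-comm (λ x c → χ (K c) u * (χ (K a) x * χ (K c) x)) ⟩
    ∑[ c < m ] ∑[ x < suc n ] (χ (K c) u * (χ (K a) x * χ (K c) x)) ≡⟨ sum-cong-≗ (λ c → *-distribˡ-sum (χ (K c) u) (λ x → χ (K a) x * χ (K c) x)) ⟨
    ∑[ c < m ] (χ (K c) u * ∑[ x < suc n ] (χ (K a) x * χ (K c) x)) ≡⟨ sum-cong-≗ (λ c → cong (χ (K c) u *_) (∣∩∣≡∑χ*χ (K a) (K c))) ⟨
    ∑[ c < m ] (χ (K c) u * ∣ K a ∩ K c ∣)                         ≤⟨ ∑-mono-≤ meets-once ⟩
    degree u                                                       ∎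
    where
    open ≤-Reasoning
    weighted : ∀ x → χ (K a) x ≡ χ (K a) x * pairCount u x
    weighted x with x ∈? K a
    ... | no  _   = refl
    ... | yes x∈ = sym (trans (*-identityˡ _) (pairCount≡1 λ u≡x → u∉Ka (subst (_∈ K a) (sym u≡x) x∈)))
    meets-once : ∀ c → χ (K c) u * ∣ K a ∩ K c ∣ ≤ χ (K c) u
    meets-once c with u ∈? K c
    ... | no  _   = z≤n
    ... | yes u∈ = ≤-trans (≤-reflexive (+-identityʳ _)) (∣∩∣≤1 λ a≡c → u∉Ka (subst (λ d → u ∈ K d) (sym a≡c) u∈))

  totalSize≥ : ∀ {b} → (∀ u → b ≤ degree u) → suc n * b ≤ totalSize 𝒞
  totalSize≥ {b} b≤degree = begin
    suc n * b                  ≡⟨ ∑-const (suc n) b ⟨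
    ∑[ u < suc n ] b           ≤⟨ ∑-mono-≤ b≤degree ⟩
    ∑[ u < suc n ] degree u    ≡⟨ totalSize≡∑degree ⟨
    totalSize 𝒞                ∎
    where open ≤-Reasoning

  -- Vertices of a clique A lie in at least two cliques, the others in at least |A|.
  totalSize-bigClique : (∀ c → ∣ K c ∣ ≤ n) → ∀ a → 3 ≤ ∣ K a ∣ → 3 * n ≤ totalSize 𝒞
  totalSize-bigClique proper a 3≤k = begin
    3 * n                                                              ≤⟨ 3n≤2k+k[n+1-k] 3≤k (proper a) ⟩
    2 * k + k * (suc n ∸ k)                                            ≡⟨ cong₂ (λ s t → 2 * s + k * t) (∣∣≡∑χ (K a)) ∣∁∣≡∑χ ⟩
    2 * ∑[ u < suc n ] χ A u + k * ∑[ u < suc n ] χ (∁ A) u            ≡⟨ cong₂ _+_ (*-distribˡ-sum 2 (χ A)) (*-distribˡ-sum k (χ (∁ A))) ⟩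
    ∑[ u < suc n ] (2 * χ A u) + ∑[ u < suc n ] (k * χ (∁ A) u)        ≡⟨ ∑-distrib-+ (λ u → 2 * χ A u) (λ u → k * χ (∁ A) u) ⟨
    ∑[ u < suc n ] (2 * χ A u + k * χ (∁ A) u)                         ≤⟨ ∑-mono-≤ lowerBound ⟩
    ∑[ u < suc n ] degree u                                            ≡⟨ totalSize≡∑degree ⟨
    totalSize 𝒞                                                        ∎
    where
    open ≤-Reasoning
    A = K a
    k = ∣ A ∣
    ∣∁∣≡∑χ : suc n ∸ k ≡ ∑[ u < suc n ] χ (∁ A) u
    ∣∁∣≡∑χ = trans (sym (∣∁p∣≡n∸∣p∣ A)) (∣∣≡∑χ (∁ A))
    lowerBound : ∀ u → 2 * χ A u + k * χ (∁ A) u ≤ degree u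
    lowerBound u with u ∈? A
    ... | yes u∈A rewrite χ-∉ (x∈p⇒x∉∁p u∈A) | *-zeroʳ k =
      2≤degree (≤-trans (s≤s z≤n) (≤-trans 3≤k (proper a))) proper u
    ... | no  u∉A rewrite χ-∈ (x∉p⇒x∈∁p u∉A) | *-identityʳ k = ∣∣≤degree u∉A

cliquePartitionBound : ∀ {n} (𝒞 : List (Subset (suc n))) → IsCliquePartitionKn 𝒞 →
                       (∀ c → ∣ lookup 𝒞 c ∣ ≤ n) → 3 * n ≤ totalSize 𝒞
cliquePartitionBound {zero}        𝒞 _           _      = z≤n
cliquePartitionBound {suc zero}    𝒞 isPartition proper =
  ≤-trans (s≤s (s≤s (s≤s z≤n))) (totalSize≥ (2≤degree ≤-refl proper))
  where open CliquePartition 𝒞 isPartition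
cliquePartitionBound {suc (suc n)} 𝒞 isPartition proper
  with any? {P = λ c → 3 ≤ ∣ lookup 𝒞 c ∣} (λ c → 3 ≤? ∣ lookup 𝒞 c ∣)
... | yes (a , 3≤∣a∣) = totalSize-bigClique proper a 3≤∣a∣
  where open CliquePartition 𝒞 isPartition
... | no  noBigClique = ≤-trans (*-monoˡ-≤ (suc (suc n)) (m≤m+n 3 n)) (totalSize≥ (n≤degree small))
  where
  open CliquePartition 𝒞 isPartition
  small : ∀ c → ∣ lookup 𝒞 c ∣ ≤ 2
  small c = ≤-pred (≰⇒> λ 3≤ → noBigClique (c , 3≤))

mainTheorem2 : (n : ℕ) (𝒞 : List (Subset n)) →
    Unique 𝒞 →
    IsCliquePartitionKn 𝒞 →
    All (λ C → ∣ C ∣ ≤ n ∸ 1) 𝒞 →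
    3 * n ∸ 3 ≤ totalSize 𝒞
mainTheorem2 zero    _ _ _           _      = z≤n
mainTheorem2 (suc n) 𝒞 _ isPartition proper =
  subst (_≤ totalSize 𝒞) (*-distribˡ-∸ 3 (suc n) 1)
        (cliquePartitionBound 𝒞 isPartition (λ c → All.lookup proper (∈-lookup c)))
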